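{- Let $D$ be the formal derivative on $\mathbb Q[a,b,c,d,t]$ with respect to the grammar $$\{a\rightarrow 3t(ad+bc),\ b\rightarrow 3t(ad+bc),\ c\rightarrow 2a,\ d\rightarrow 2b,\ t\rightarrow t^2(c+d)\}.$$ Then for every $n\ge2$, $$D^n(d)=(n+1)!\,\widetilde G_n(a,b,c,d;t).$$
   Context: A formal derivative with respect to a grammar (substitution rules $z\to f_z$ for variables $z$) is the linear operator $D$ with $D(z)=f_z$, $D(uv)=D(u)v+uD(v)$, $D(c_0)=0$ for constants $c_0$. A plane tree is an unlabeled rooted tree in which the children of every vertex are linearly ordered; $\mathcal P_n$ is the set of plane trees with $n$ edges. A leaf is a vertex with no children, an interior vertex one with at least one child. A leaf without siblings is a singleton leaf; a leaf with siblings is an elder leaf if it is the leftmost child of its parent, and a young leaf otherwise; an interior vertex is a young interior vertex if it is not the parent of a singleton leaf or of an elder leaf. An edge is a young edge if its lower endpoint (the child) is neither a singleton leaf nor an elder leaf. For $T\in\mathcal P_n$, $\mathrm{sleaf},\mathrm{eleaf},\mathrm{yleaf},\mathrm{yint},\mathrm{yedge}$ count singleton leaves, elder leaves, young leaves, young interior vertices and young edges. For $n\ge2$, $\widetilde G_n(a,b,c,d;t)=\sum_{T\in\mathcal P_n}a^{\mathrm{sleaf}(T)}b^{\mathrm{eleaf}(T)}c^{\mathrm{yleaf}(T)}d^{\mathrm{yint}(T)}t^{\mathrm{yedge}(T)}$. -}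

module Defs where

open import Data.Nat using (ℕ; zero; suc; _+_; _≡ᵇ_; _≤ᵇ_)
open import Data.Bool using (Bool; true; false; if_then_else_; _∧_; _∨_; not)
open import Data.Fin using (Fin; zero; suc)
open import Data.List using (List; []; _∷_; _++_; map; length; concatMap; allFin; foldr)
open import Data.Vec using (Vec; []; _∷_; lookup; zipWith; updateAt; replicate)
import Data.Vec.Properties as VecP
open import Data.Product using (_×_; _,_)
open import Data.Integer using (+_)
open import Data.Rational using (ℚ; _/_; 0ℚ; 1ℚ) renaming (_*_ to _*ℚ_; _+_ to _+ℚ_)
open import Relation.Nullary using (yes; no)
open import Relation.Binary.PropositionalEquality using (_≡_)

-- Polynomials in ℚ[a,b,c,d,t]
-- A monomial is its exponent vector (a, b, c, d, t), in this order.

Mono : Set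
Mono = Vec ℕ 5

Poly : Set
Poly = List (ℚ × Mono)

ℕ→ℚ : ℕ → ℚ
ℕ→ℚ n = (+ n) / 1

coeff : Poly → Mono → ℚ
coeff [] m = 0ℚ
coeff ((c , e) ∷ p) m with VecP.≡-dec Data.Nat._≟_ e m
... | yes _ = c +ℚ coeff p m
... | no _  = coeff p m

_≈P_ : Poly → Poly → Set
p ≈P q = ∀ (m : Mono) → coeff p m ≡ coeff q m

infix 4 _≈P_

termMul : ℚ × Mono → Poly → Poly
termMul (c , e) = map (λ { (c' , e') → (c *ℚ c' , zipWith _+_ e e') })

_*P_ : Poly → Poly → Poly
p *P q = concatMap (λ τ → termMul τ q) p

scaleP : ℚ → Poly → Poly
scaleP c = termMul (c , replicate 5 0)

mono : ℕ → ℕ → ℕ → ℕ → ℕ → Mono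
mono i j k l m = i ∷ j ∷ k ∷ l ∷ m ∷ []

grammar : Fin 5 → Poly
grammar zero                      = (ℕ→ℚ 3 , mono 1 0 0 1 1) ∷ (ℕ→ℚ 3 , mono 0 1 1 0 1) ∷ []
grammar (suc zero)                = (ℕ→ℚ 3 , mono 1 0 0 1 1) ∷ (ℕ→ℚ 3 , mono 0 1 1 0 1) ∷ []
grammar (suc (suc zero))          = (ℕ→ℚ 2 , mono 1 0 0 0 0) ∷ []
grammar (suc (suc (suc zero)))    = (ℕ→ℚ 2 , mono 0 1 0 0 0) ∷ []
grammar (suc (suc (suc (suc zero)))) = (1ℚ , mono 0 0 1 0 2) ∷ (1ℚ , mono 0 0 0 1 2) ∷ []

derivTermAt : (Fin 5 → Poly) → ℚ × Mono → Fin 5 → Poly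
derivTermAt f (c , e) i with lookup e i
... | zero  = []
... | suc k = termMul (c *ℚ ℕ→ℚ (suc k) , updateAt e i (λ _ → k)) (f i)

derivTerm : (Fin 5 → Poly) → ℚ × Mono → Poly
derivTerm f τ = concatMap (derivTermAt f τ) (allFin 5)

Der : (Fin 5 → Poly) → Poly → Poly
Der f = concatMap (derivTerm f)

iterate : ℕ → (Poly → Poly) → Poly → Poly
iterate zero    F p = p
iterate (suc n) F p = F (iterate n F p)

varD : Poly
varD = (1ℚ , mono 0 0 0 1 0) ∷ []

data PTree : Set where
  node : List PTree → PTree

mutual
  edges : PTree → ℕ
  edges (node ts) = length ts + edgesList ts

  edgesList : List PTree → ℕ
  edgesList []       = 0
  edgesList (t ∷ ts) = edges t + edgesList ts

isLeaf : PTree → Bool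
isLeaf (node []) = true
isLeaf (node (_ ∷ _)) = false

-- classification of a child c at position pos (0 = leftmost) among
-- `total` siblings-including-itself
isSingletonLeaf : ℕ → ℕ → PTree → Bool
isSingletonLeaf total pos c = isLeaf c ∧ (total ≡ᵇ 1)

isElderLeaf : ℕ → ℕ → PTree → Bool
isElderLeaf total pos c = isLeaf c ∧ (2 ≤ᵇ total) ∧ (pos ≡ᵇ 0)

isYoungLeaf : ℕ → ℕ → PTree → Bool
isYoungLeaf total pos c = isLeaf c ∧ (2 ≤ᵇ total) ∧ (1 ≤ᵇ pos)

isYoungEdge : ℕ → ℕ → PTree → Bool
isYoungEdge total pos c = not (isSingletonLeaf total pos c ∨ isElderLeaf total pos c)

hasSEChild : ℕ → ℕ → List PTree → Bool
hasSEChild total pos [] = false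
hasSEChild total pos (c ∷ cs) =
  isSingletonLeaf total pos c ∨ isElderLeaf total pos c ∨ hasSEChild total (suc pos) cs

isYoungInterior : List PTree → Bool
isYoungInterior []       = false
isYoungInterior (c ∷ cs) = not (hasSEChild (length (c ∷ cs)) 0 (c ∷ cs))

b2n : Bool → ℕ
b2n true  = 1
b2n false = 0

mutual
  count : (List PTree → Bool) → (ℕ → ℕ → PTree → Bool) → PTree → ℕ
  count own ch (node ts) = b2n (own ts) + countCh own ch (length ts) 0 ts

  countCh : (List PTree → Bool) → (ℕ → ℕ → PTree → Bool) → ℕ → ℕ → List PTree → ℕ
  countCh own ch total pos []       = 0
  countCh own ch total pos (c ∷ cs) =
    b2n (ch total pos c) + count own ch c + countCh own ch total (suc pos) cs

noOwn : List PTree → Bool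
noOwn _ = false

noCh : ℕ → ℕ → PTree → Bool
noCh _ _ _ = false

sleaf eleaf yleaf yint yedge : PTree → ℕ
sleaf = count noOwn isSingletonLeaf
eleaf = count noOwn isElderLeaf
yleaf = count noOwn isYoungLeaf
yint  = count isYoungInterior noCh
yedge = count noOwn isYoungEdge

weight : PTree → Mono
weight T = mono (sleaf T) (eleaf T) (yleaf T) (yint T) (yedge T)

GenPoly : List PTree → Poly
GenPoly L = map (λ T → (1ℚ , weight T)) L

-- Both sides are compared as multisets of monomials.  The grammar has natural coefficients, so
-- D^n(d) is a list of monomials with repetitions, and the claim is that it is a permutation of
-- (n+1)! copies of the weights of the plane trees with n edges.
--
-- Under the rotation correspondence, plane trees with n edges become binary trees with n
-- internal nodes, and the five statistics become local: every internal node contributes one of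
-- the monomials a, b, ct, dt, t.  Rémy's growth replaces a subtree u by fork u leaf or
-- fork leaf u; the grammar is such that D applied to the weight of a binary tree gives exactly
-- the weights of its growths (induction on the tree, using the Leibniz rule).  Conversely, each
-- binary tree with n+1 internal nodes is obtained in exactly n+2 ways by growing a tree with n
-- internal nodes, because its growth steps can be undone at any of its n+2 leaves.  Hence D maps
-- (n+1)! copies of the weights of size n to (n+2)! copies of the weights of size n+1; the
-- induction starts at n = 2, which is a direct computation.

module Submission where

open import Defs
open import Data.Nat using (ℕ; suc; _≤_)
open import Data.Nat using (_!)
open import Data.List using (List)
open import Data.List.Membership.Propositional using (_∈_)
open import Data.List.Relation.Unary.Unique.Propositional using (Unique)
open import Relation.Binary.PropositionalEquality using (_≡_)
open import Function.Bundles using (_⇔_)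

open import Data.Bool using (Bool; true; false; T; not; _∧_)
open import Data.Empty using (⊥-elim)
open import Data.Fin using (Fin; zero; suc)
import Data.Integer as ℤ
import Data.Integer.Properties as ℤ
open import Data.List using ([]; _∷_; _++_; [_]; map; concat; concatMap; replicate; length; null; allFin; filter; cartesianProductWith)
import Data.List.Properties as List
open import Data.List.Membership.Propositional using (_∉_)
open import Data.List.Membership.Propositional.Properties
  using (∈-∃++; ∈-filter⁺; ∈-filter⁻; ∈-cartesianProductWith⁺; ∈-cartesianProductWith⁻; ∈-map⁺; ∈-map⁻)
open import Data.List.Relation.Binary.Permutation.Propositional as Perm
  using (_↭_; ↭-refl; ↭-sym; ↭-trans; ↭-reflexive; prep; swap; module PermutationReasoning)
import Data.List.Relation.Binary.Permutation.Propositional.Properties as ↭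
open import Data.List.Relation.Unary.All using (All; []; _∷_)
import Data.List.Relation.Unary.All as All
import Data.List.Relation.Unary.All.Properties as All
open import Data.List.Relation.Unary.AllPairs using ([]; _∷_)
open import Data.List.Relation.Unary.Any using (here; there)
import Data.List.Relation.Unary.Unique.Propositional.Properties as Unique
open import Data.Maybe using (Maybe; just; nothing)
import Data.Maybe as Maybe
open import Data.Nat using (zero; _+_; _*_; pred; _≤?_; _≟_; _≡ᵇ_; z≤n; s≤s)
import Data.Nat.Properties as ℕ
open import Algebra.Properties.CommutativeSemigroup ℕ.+-commutativeSemigroup using (interchange)
open import Data.Nat.Coprimality using (1-coprimeTo) renaming (sym to coprime-sym)
open import Data.Nat.ListAction using (sum)
open import Data.Nat.Tactic.RingSolver using (solve-∀)
open import Data.Product using (_×_; _,_; proj₁; proj₂)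
open import Data.Rational using (mkℚ; _/_)
import Data.Rational as ℚ
import Data.Rational.Properties as ℚ
open import Data.Vec using (Vec; []; _∷_; lookup; zipWith; updateAt; tabulate)
import Data.Vec.Properties as Vec
open import Function using (_∘_)
open import Function.Bundles using (mk⇔; Equivalence)
open import Relation.Binary.Definitions using (DecidableEquality)
open import Relation.Binary.PropositionalEquality using (_≢_; refl; sym; trans; cong; cong₂; subst; module ≡-Reasoning)
open import Relation.Nullary using (yes; no)

private variable A B : Set

-- Lists and permutations

concatMap⁺ : ∀ (f : A → List B) {xs ys} → xs ↭ ys → concatMap f xs ↭ concatMap f ys
concatMap⁺ f Perm.refl         = ↭-refl
concatMap⁺ f (prep x p)        = ↭.++⁺ˡ (f x) (concatMap⁺ f p)
concatMap⁺ f (swap x y p)      = ↭-trans (↭.shifts (f x) (f y)) (↭.++⁺ˡ (f y) (↭.++⁺ˡ (f x) (concatMap⁺ f p)))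
concatMap⁺ f (Perm.trans p q)  = ↭-trans (concatMap⁺ f p) (concatMap⁺ f q)

concatMap-cong-local-↭ : ∀ {f g : A → List B} xs → (∀ {x} → x ∈ xs → f x ↭ g x) →
                         concatMap f xs ↭ concatMap g xs
concatMap-cong-local-↭ []       f↭g = ↭-refl
concatMap-cong-local-↭ (x ∷ xs) f↭g = ↭.++⁺ (f↭g (here refl)) (concatMap-cong-local-↭ xs (f↭g ∘ there))

replicate-+ : ∀ m n (x : A) → replicate (m + n) x ≡ replicate m x ++ replicate n x
replicate-+ zero    n x = refl
replicate-+ (suc m) n x = cong (x ∷_) (replicate-+ m n x)

replicate-*-cong : ∀ m c {x y : A} → (m ≢ 0 → x ≡ y) → replicate (m * c) x ≡ replicate (m * c) y
replicate-*-cong zero    c x≡y = refl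
replicate-*-cong (suc m) c x≡y = cong (replicate _) (x≡y (λ ()))

concatMap-++-↭ : ∀ (f g : A → List B) xs →
                 concatMap (λ x → f x ++ g x) xs ↭ concatMap f xs ++ concatMap g xs
concatMap-++-↭ f g []       = ↭-refl
concatMap-++-↭ f g (x ∷ xs) = begin
  (f x ++ g x) ++ concatMap (λ x → f x ++ g x) xs ≡⟨ List.++-assoc (f x) (g x) _ ⟩
  f x ++ g x ++ concatMap (λ x → f x ++ g x) xs   ↭⟨ ↭.++⁺ˡ (f x) (↭.++⁺ˡ (g x) (concatMap-++-↭ f g xs)) ⟩
  f x ++ g x ++ concatMap f xs ++ concatMap g xs   ↭⟨ ↭.++⁺ˡ (f x) (↭.shifts (g x) (concatMap f xs)) ⟩
  f x ++ concatMap f xs ++ g x ++ concatMap g xs   ≡⟨ List.++-assoc (f x) (concatMap f xs) _ ⟨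
  (f x ++ concatMap f xs) ++ g x ++ concatMap g xs ∎
  where open PermutationReasoning

copies : ℕ → List A → List A
copies k xs = concat (replicate k xs)

copies-+ : ∀ j k (xs : List A) → copies (j + k) xs ≡ copies j xs ++ copies k xs
copies-+ zero    k xs = refl
copies-+ (suc j) k xs = trans (cong (xs ++_) (copies-+ j k xs)) (sym (List.++-assoc xs _ _))

copies-* : ∀ j k (xs : List A) → copies j (copies k xs) ≡ copies (j * k) xs
copies-* zero    k xs = refl
copies-* (suc j) k xs = trans (cong (copies k xs ++_) (copies-* j k xs)) (sym (copies-+ k (j * k) xs))

map-copies : ∀ (f : A → B) k xs → map f (copies k xs) ≡ copies k (map f xs)
map-copies f zero    xs = refl
map-copies f (suc k) xs = trans (List.map-++ f xs _) (cong (map f xs ++_) (map-copies f k xs))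

concatMap-copies : ∀ (f : A → List B) k xs → concatMap f (copies k xs) ≡ copies k (concatMap f xs)
concatMap-copies f zero    xs = refl
concatMap-copies f (suc k) xs = trans (List.concatMap-++ f xs _) (cong (concatMap f xs ++_) (concatMap-copies f k xs))

concatMap-replicate : ∀ (f : A → List B) k x → concatMap f (replicate k x) ≡ copies k (f x)
concatMap-replicate f k x = cong concat (List.map-replicate f k x)

copies⁺ : ∀ k {xs ys : List A} → xs ↭ ys → copies k xs ↭ copies k ys
copies⁺ zero    p = ↭-refl
copies⁺ (suc k) p = ↭.++⁺ p (copies⁺ k p)

sum-map-+ : ∀ (f g : A → ℕ) xs → sum (map (λ x → f x + g x) xs) ≡ sum (map f xs) + sum (map g xs)
sum-map-+ f g []       = refl
sum-map-+ f g (x ∷ xs) = trans (cong (f x + g x +_) (sum-map-+ f g xs)) (interchange (f x) (g x) _ _)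

sum-map-const : ∀ {f : A → ℕ} {c xs} → All (λ x → f x ≡ c) xs → sum (map f xs) ≡ length xs * c
sum-map-const []         = refl
sum-map-const (fx≡c ∷ p) = cong₂ _+_ fx≡c (sum-map-const p)

sum-map-0 : (xs : List A) → sum (map (λ _ → 0) xs) ≡ 0
sum-map-0 []       = refl
sum-map-0 (x ∷ xs) = sum-map-0 xs

module Multiset {A : Set} (_≟_ : DecidableEquality A) where

  open import Data.List.Membership.DecPropositional _≟_ using (_∈?_)

  δ : A → A → ℕ
  δ x y with x ≟ y
  ... | yes _ = 1
  ... | no  _ = 0

  δ-refl : ∀ x → δ x x ≡ 1
  δ-refl x with x ≟ x
  ... | yes _  = refl
  ... | no x≢x = ⊥-elim (x≢x refl)

  δ-≢ : ∀ {x y} → x ≢ y → δ x y ≡ 0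
  δ-≢ {x} {y} x≢y with x ≟ y
  ... | yes x≡y = ⊥-elim (x≢y x≡y)
  ... | no  _   = refl

  δ-sym : ∀ x y → δ x y ≡ δ y x
  δ-sym x y with x ≟ y
  ... | yes refl = sym (δ-refl x)
  ... | no  x≢y  = sym (δ-≢ (x≢y ∘ sym))

  multiplicity : A → List A → ℕ
  multiplicity x []       = 0
  multiplicity x (y ∷ ys) = δ y x + multiplicity x ys

  multiplicity-++ : ∀ x xs ys → multiplicity x (xs ++ ys) ≡ multiplicity x xs + multiplicity x ys
  multiplicity-++ x []       ys = refl
  multiplicity-++ x (y ∷ xs) ys = trans (cong (δ y x +_) (multiplicity-++ x xs ys)) (sym (ℕ.+-assoc (δ y x) _ _))

  multiplicity-replicate : ∀ x k y → multiplicity x (replicate k y) ≡ k * δ y x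
  multiplicity-replicate x zero    y = refl
  multiplicity-replicate x (suc k) y = cong (δ y x +_) (multiplicity-replicate x k y)

  multiplicity-concatMap : ∀ x (f : B → List A) bs → multiplicity x (concatMap f bs) ≡ sum (map (multiplicity x ∘ f) bs)
  multiplicity-concatMap x f []       = refl
  multiplicity-concatMap x f (b ∷ bs) =
    trans (multiplicity-++ x (f b) _) (cong (multiplicity x (f b) +_) (multiplicity-concatMap x f bs))

  multiplicity-↭ : ∀ {xs ys} → xs ↭ ys → ∀ x → multiplicity x xs ≡ multiplicity x ys
  multiplicity-↭ Perm.refl        x = refl
  multiplicity-↭ (prep y p)       x = cong (δ y x +_) (multiplicity-↭ p x)
  multiplicity-↭ (swap y z p)     x = begin
    δ y x + (δ z x + _) ≡⟨ ℕ.+-assoc (δ y x) _ _ ⟨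
    δ y x + δ z x + _   ≡⟨ cong₂ _+_ (ℕ.+-comm (δ y x) (δ z x)) (multiplicity-↭ p x) ⟩
    δ z x + δ y x + _   ≡⟨ ℕ.+-assoc (δ z x) _ _ ⟩
    δ z x + (δ y x + _) ∎
    where open ≡-Reasoning
  multiplicity-↭ (Perm.trans p q) x = trans (multiplicity-↭ p x) (multiplicity-↭ q x)

  multiplicity≢0⇒∈ : ∀ {x} xs → multiplicity x xs ≢ 0 → x ∈ xs
  multiplicity≢0⇒∈ {x} []       c≢0 = ⊥-elim (c≢0 refl)
  multiplicity≢0⇒∈ {x} (y ∷ ys) c≢0 with y ≟ x
  ... | yes refl = here refl
  ... | no  _    = there (multiplicity≢0⇒∈ ys c≢0)

  multiplicity-here : ∀ x xs → multiplicity x (x ∷ xs) ≡ suc (multiplicity x xs)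
  multiplicity-here x xs = cong (_+ multiplicity x xs) (δ-refl x)

  ↭-fromMultiplicities : ∀ xs ys → (∀ x → multiplicity x xs ≡ multiplicity x ys) → xs ↭ ys
  ↭-fromMultiplicities []       []       _  = ↭-refl
  ↭-fromMultiplicities []       (y ∷ ys) eq = ⊥-elim (ℕ.1+n≢0 (trans (sym (multiplicity-here y ys)) (sym (eq y))))
  ↭-fromMultiplicities (x ∷ xs) ys       eq
    with ∈-∃++ (multiplicity≢0⇒∈ ys (ℕ.1+n≢0 ∘ trans (sym (multiplicity-here x xs)) ∘ trans (eq x)))
  ... | ys₁ , ys₂ , refl = ↭-trans (prep x (↭-fromMultiplicities xs (ys₁ ++ ys₂) rest)) (↭-sym (↭.shift x ys₁ ys₂))
    where
    rest : ∀ z → multiplicity z xs ≡ multiplicity z (ys₁ ++ ys₂)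
    rest z = ℕ.+-cancelˡ-≡ (δ x z) (multiplicity z xs) _ (trans (eq z) (multiplicity-↭ (↭.shift x ys₁ ys₂) z))

  multiplicity-copies : ∀ x k xs → multiplicity x (copies k xs) ≡ k * multiplicity x xs
  multiplicity-copies x zero    xs = refl
  multiplicity-copies x (suc k) xs =
    trans (multiplicity-++ x xs _) (cong (multiplicity x xs +_) (multiplicity-copies x k xs))

  multiplicity-concatMap-scale : ∀ x k (F G : B → List A) →
                                 (∀ b → multiplicity x (F b) ≡ k * multiplicity x (G b)) →
                                 ∀ bs → multiplicity x (concatMap F bs) ≡ k * multiplicity x (concatMap G bs)
  multiplicity-concatMap-scale x k F G F≡kG []       = sym (ℕ.*-zeroʳ k)
  multiplicity-concatMap-scale x k F G F≡kG (b ∷ bs) = begin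
    multiplicity x (F b ++ concatMap F bs)
      ≡⟨ multiplicity-++ x (F b) _ ⟩
    multiplicity x (F b) + multiplicity x (concatMap F bs)
      ≡⟨ cong₂ _+_ (F≡kG b) (multiplicity-concatMap-scale x k F G F≡kG bs) ⟩
    k * multiplicity x (G b) + k * multiplicity x (concatMap G bs)
      ≡⟨ ℕ.*-distribˡ-+ k _ _ ⟨
    k * (multiplicity x (G b) + multiplicity x (concatMap G bs))
      ≡⟨ cong (k *_) (multiplicity-++ x (G b) _) ⟨
    k * multiplicity x (G b ++ concatMap G bs) ∎
    where open ≡-Reasoning

  multiplicity-∉ : ∀ {x} xs → x ∉ xs → multiplicity x xs ≡ 0
  multiplicity-∉ []       x∉ = refl
  multiplicity-∉ (y ∷ ys) x∉ = trans (cong (_+ _) (δ-≢ (λ y≡x → x∉ (here (sym y≡x))))) (multiplicity-∉ ys (x∉ ∘ there))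

  multiplicity-∈-unique : ∀ {x xs} → Unique xs → x ∈ xs → multiplicity x xs ≡ 1
  multiplicity-∈-unique {x} {y ∷ ys} (y∉ys ∷ _) (here refl) =
    cong₂ _+_ (δ-refl x) (multiplicity-∉ ys (λ x∈ys → All.lookup y∉ys x∈ys refl))
  multiplicity-∈-unique {x} {y ∷ ys} (y∉ys ∷ u) (there x∈ys) =
    cong₂ _+_ (δ-≢ (λ y≡x → All.lookup y∉ys x∈ys y≡x)) (multiplicity-∈-unique u x∈ys)

  ↭-fromSameMembers : ∀ {xs ys} → Unique xs → Unique ys → (∀ x → x ∈ xs ⇔ x ∈ ys) → xs ↭ ys
  ↭-fromSameMembers {xs} {ys} xs! ys! xs⇔ys = ↭-fromMultiplicities xs ys multiplicities
    where
    multiplicities : ∀ x → multiplicity x xs ≡ multiplicity x ys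
    multiplicities x with x ∈? xs
    ... | yes x∈xs = trans (multiplicity-∈-unique xs! x∈xs)
                           (sym (multiplicity-∈-unique ys! (Equivalence.to (xs⇔ys x) x∈xs)))
    ... | no  x∉xs = trans (multiplicity-∉ xs x∉xs) (sym (multiplicity-∉ ys (x∉xs ∘ Equivalence.from (xs⇔ys x))))

  sum-multiplicity-comm : ∀ xs ys → sum (map (λ x → multiplicity x ys) xs) ≡ sum (map (λ y → multiplicity y xs) ys)
  sum-multiplicity-comm []       ys = sym (sum-map-0 ys)
  sum-multiplicity-comm (x ∷ xs) ys = begin
    multiplicity x ys + sum (map (λ x → multiplicity x ys) xs)
      ≡⟨ cong₂ _+_ (multiplicity-as-sum ys) (sum-multiplicity-comm xs ys) ⟩
    sum (map (δ x) ys) + sum (map (λ y → multiplicity y xs) ys)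
      ≡⟨ sum-map-+ (δ x) (λ y → multiplicity y xs) ys ⟨
    sum (map (λ y → δ x y + multiplicity y xs) ys) ∎
    where
    open ≡-Reasoning
    multiplicity-as-sum : ∀ ys → multiplicity x ys ≡ sum (map (δ x) ys)
    multiplicity-as-sum []       = refl
    multiplicity-as-sum (y ∷ ys) = cong₂ _+_ (δ-sym y x) (multiplicity-as-sum ys)

  remove : A → List A → Maybe (List A)
  remove x []       = nothing
  remove x (y ∷ ys) with x ≟ y
  ... | yes _ = just ys
  ... | no  _ = Maybe.map (y ∷_) (remove x ys)

  remove-↭ : ∀ x ys {zs} → remove x ys ≡ just zs → ys ↭ x ∷ zs
  remove-↭ x (y ∷ ys) eq with x ≟ y
  remove-↭ x (y ∷ ys) refl | yes refl = ↭-refl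
  remove-↭ x (y ∷ ys) eq   | no  _ with remove x ys in eq′
  remove-↭ x (y ∷ ys) refl | no  _ | just zs = ↭-trans (prep y (remove-↭ x ys eq′)) (swap y x ↭-refl)

  isPermutation : List A → List A → Bool
  isPermutation []       ys = null ys
  isPermutation (x ∷ xs) ys with remove x ys
  ... | just zs = isPermutation xs zs
  ... | nothing = false

  isPermutation-sound : ∀ xs ys → T (isPermutation xs ys) → xs ↭ ys
  isPermutation-sound []       []       _ = ↭-refl
  isPermutation-sound (x ∷ xs) ys       t with remove x ys in eq
  ... | just zs = ↭-trans (prep x (isPermutation-sound xs zs t)) (↭-sym (remove-↭ x ys eq))

-- Polynomials with natural coefficients

ℕ→ℚ-mkℚ : ∀ n → ℕ→ℚ n ≡ mkℚ (ℤ.+ n) 0 (coprime-sym (1-coprimeTo n))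
ℕ→ℚ-mkℚ n = ℚ.normalize-coprime (coprime-sym (1-coprimeTo n))

ℕ→ℚ-homo-* : ∀ m n → ℕ→ℚ m ℚ.* ℕ→ℚ n ≡ ℕ→ℚ (m * n)
ℕ→ℚ-homo-* m n rewrite ℕ→ℚ-mkℚ m | ℕ→ℚ-mkℚ n = cong (_/ 1) (sym (ℤ.pos-* m n))

ℕ→ℚ-homo-+ : ∀ m n → ℕ→ℚ m ℚ.+ ℕ→ℚ n ≡ ℕ→ℚ (m + n)
ℕ→ℚ-homo-+ m n rewrite ℕ→ℚ-mkℚ m | ℕ→ℚ-mkℚ n =
  cong (_/ 1) (trans (cong₂ ℤ._+_ (ℤ.*-identityʳ (ℤ.+ m)) (ℤ.*-identityʳ (ℤ.+ n))) (sym (ℤ.pos-+ m n)))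

infixr 6 _⊕_

_⊕_ : ∀ {n} → Vec ℕ n → Vec ℕ n → Vec ℕ n
_⊕_ = zipWith _+_

⊕-assoc : ∀ {n} (x y z : Vec ℕ n) → (x ⊕ y) ⊕ z ≡ x ⊕ (y ⊕ z)
⊕-assoc = Vec.zipWith-assoc ℕ.+-assoc

⊕-comm : ∀ {n} (x y : Vec ℕ n) → x ⊕ y ≡ y ⊕ x
⊕-comm = Vec.zipWith-comm ℕ.+-comm

0ᵥ : Mono
0ᵥ = mono 0 0 0 0 0

⊕-identityˡ : ∀ x → 0ᵥ ⊕ x ≡ x
⊕-identityˡ = Vec.zipWith-identityˡ ℕ.+-identityˡ

⊕-identityʳ : ∀ x → x ⊕ 0ᵥ ≡ x
⊕-identityʳ = Vec.zipWith-identityʳ ℕ.+-identityʳ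

updateAt-pred-⊕ˡ : ∀ {n} (x y : Vec ℕ n) i → lookup x i ≢ 0 → updateAt (x ⊕ y) i pred ≡ updateAt x i pred ⊕ y
updateAt-pred-⊕ˡ (zero  ∷ x) (b ∷ y) zero    x₀≢0 = ⊥-elim (x₀≢0 refl)
updateAt-pred-⊕ˡ (suc a ∷ x) (b ∷ y) zero    _    = refl
updateAt-pred-⊕ˡ (a ∷ x)     (b ∷ y) (suc i) xᵢ≢0 = cong (a + b ∷_) (updateAt-pred-⊕ˡ x y i xᵢ≢0)

updateAt-pred-⊕ʳ : ∀ {n} (x y : Vec ℕ n) i → lookup y i ≢ 0 → updateAt (x ⊕ y) i pred ≡ x ⊕ updateAt y i pred
updateAt-pred-⊕ʳ (a ∷ x) (zero  ∷ y) zero    y₀≢0 = ⊥-elim (y₀≢0 refl)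
updateAt-pred-⊕ʳ (a ∷ x) (suc b ∷ y) zero    _    = cong (λ n → pred n ∷ x ⊕ y) (ℕ.+-suc a b)
updateAt-pred-⊕ʳ (a ∷ x) (b ∷ y)     (suc i) yᵢ≢0 = cong (a + b ∷_) (updateAt-pred-⊕ʳ x y i yᵢ≢0)

ℕPoly : Set
ℕPoly = List (ℕ × Mono)

embed : ℕPoly → Poly
embed = map (λ (k , e) → (ℕ→ℚ k , e))

embed-++ : ∀ P Q → embed (P ++ Q) ≡ embed P ++ embed Q
embed-++ = List.map-++ _

embed-concatMap : ∀ (F : A → Poly) (G : A → ℕPoly) → (∀ x → F x ≡ embed (G x)) →
                  ∀ xs → concatMap F xs ≡ embed (concatMap G xs)
embed-concatMap F G F≡G []       = refl
embed-concatMap F G F≡G (x ∷ xs) = trans (cong₂ _++_ (F≡G x) (embed-concatMap F G F≡G xs)) (sym (embed-++ (G x) _))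

monomials : ℕPoly → List Mono
monomials = concatMap (λ (k , e) → replicate k e)

_≟ₘ_ : DecidableEquality Mono
_≟ₘ_ = Vec.≡-dec ℕ._≟_

open Multiset _≟ₘ_

multiplicity-monomials-∷ : ∀ c e P m → multiplicity m (monomials ((c , e) ∷ P)) ≡ c * δ e m + multiplicity m (monomials P)
multiplicity-monomials-∷ c e P m = trans (multiplicity-++ m (replicate c e) _) (cong (_+ _) (multiplicity-replicate m c e))

coeff-embed : ∀ P m → coeff (embed P) m ≡ ℕ→ℚ (multiplicity m (monomials P))
coeff-embed []            m = refl
coeff-embed ((c , e) ∷ P) m with e ≟ₘ m
... | yes refl = begin
  ℕ→ℚ c ℚ.+ coeff (embed P) e                   ≡⟨ cong (ℕ→ℚ c ℚ.+_) (coeff-embed P e) ⟩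
  ℕ→ℚ c ℚ.+ ℕ→ℚ (multiplicity e (monomials P)) ≡⟨ ℕ→ℚ-homo-+ c _ ⟩
  ℕ→ℚ (c + multiplicity e (monomials P))
    ≡⟨ cong (λ k → ℕ→ℚ (k + multiplicity e (monomials P))) (trans (cong (c *_) (δ-refl e)) (ℕ.*-identityʳ c)) ⟨
  ℕ→ℚ (c * δ e e + multiplicity e (monomials P)) ≡⟨ cong ℕ→ℚ (multiplicity-monomials-∷ c e P e) ⟨
  ℕ→ℚ (multiplicity e (monomials ((c , e) ∷ P))) ∎
  where open ≡-Reasoning
... | no  e≢m  = begin
  coeff (embed P) m                             ≡⟨ coeff-embed P m ⟩
  ℕ→ℚ (multiplicity m (monomials P))
    ≡⟨ cong (λ k → ℕ→ℚ (k + multiplicity m (monomials P))) (trans (cong (c *_) (δ-≢ e≢m)) (ℕ.*-zeroʳ c)) ⟨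
  ℕ→ℚ (c * δ e m + multiplicity m (monomials P)) ≡⟨ cong ℕ→ℚ (multiplicity-monomials-∷ c e P m) ⟨
  ℕ→ℚ (multiplicity m (monomials ((c , e) ∷ P))) ∎
  where open ≡-Reasoning

coeff-embed-↭ : ∀ P Q → monomials P ↭ monomials Q → embed P ≈P embed Q
coeff-embed-↭ P Q P↭Q m = trans (coeff-embed P m) (trans (cong ℕ→ℚ (multiplicity-↭ P↭Q m)) (sym (coeff-embed Q m)))

monomials-++ : ∀ P Q → monomials (P ++ Q) ≡ monomials P ++ monomials Q
monomials-++ = List.concatMap-++ _

monomials-concatMap : ∀ (F : A → ℕPoly) xs → monomials (concatMap F xs) ≡ concatMap (monomials ∘ F) xs
monomials-concatMap F []       = refl
monomials-concatMap F (x ∷ xs) = trans (monomials-++ (F x) _) (cong (monomials (F x) ++_) (monomials-concatMap F xs))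

module ℕDerivative (g : Fin 5 → ℕPoly) where

  termMulℕ : ℕ × Mono → ℕPoly → ℕPoly
  termMulℕ (c , e) = map (λ (c′ , e′) → (c * c′ , e ⊕ e′))

  derivTermAtℕ : ℕ × Mono → Fin 5 → ℕPoly
  derivTermAtℕ (c , e) i with lookup e i
  ... | zero  = []
  ... | suc k = termMulℕ (c * suc k , updateAt e i (λ _ → k)) (g i)

  Derℕ : ℕPoly → ℕPoly
  Derℕ = concatMap (λ τ → concatMap (derivTermAtℕ τ) (allFin 5))

  iterateDerℕ : ℕ → ℕPoly → ℕPoly
  iterateDerℕ zero    P = P
  iterateDerℕ (suc n) P = Derℕ (iterateDerℕ n P)

  module _ (f : Fin 5 → Poly) (f≡g : ∀ i → f i ≡ embed (g i)) where

    termMul-embed : ∀ c e Q → termMul (ℕ→ℚ c , e) (embed Q) ≡ embed (termMulℕ (c , e) Q)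
    termMul-embed c e []              = refl
    termMul-embed c e ((c′ , e′) ∷ Q) = cong₂ _∷_ (cong (_, e ⊕ e′) (ℕ→ℚ-homo-* c c′)) (termMul-embed c e Q)

    derivTermAt-embed : ∀ c e i → derivTermAt f (ℕ→ℚ c , e) i ≡ embed (derivTermAtℕ (c , e) i)
    derivTermAt-embed c e i with lookup e i
    ... | zero  = refl
    ... | suc k rewrite ℕ→ℚ-homo-* c (suc k) | f≡g i = termMul-embed (c * suc k) _ (g i)

    Der-embed : ∀ P → Der f (embed P) ≡ embed (Derℕ P)
    Der-embed []            = refl
    Der-embed ((c , e) ∷ P) = trans
      (cong₂ _++_ (embed-concatMap _ _ (derivTermAt-embed c e) (allFin 5)) (Der-embed P))
      (sym (embed-++ (concatMap (derivTermAtℕ (c , e)) (allFin 5)) _))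

    iterate-embed : ∀ n P → iterate n (Der f) (embed P) ≡ embed (iterateDerℕ n P)
    iterate-embed zero    P = refl
    iterate-embed (suc n) P = trans (cong (Der f) (iterate-embed n P)) (Der-embed (iterateDerℕ n P))

  -- Unlike `derivTermAtℕ` this does not branch on
  -- the exponent (a zero exponent gives empty replicates), which makes the Leibniz rule `∂-⊕`
  -- hold site by site.
  ∂-at : Mono → Fin 5 → ℕ × Mono → List Mono
  ∂-at e i (c , h) = replicate (lookup e i * c) (updateAt e i pred ⊕ h)

  ∂ : Mono → List Mono
  ∂ e = concatMap (λ i → concatMap (∂-at e i) (g i)) (allFin 5)

  multiplicity-derivTermAt : ∀ m k e i →
    multiplicity m (monomials (derivTermAtℕ (k , e) i)) ≡ k * multiplicity m (concatMap (∂-at e i) (g i))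
  multiplicity-derivTermAt m k e i with lookup e i in eq
  ... | zero  = sym (trans (cong (λ xs → k * multiplicity m xs) (vanish (g i))) (ℕ.*-zeroʳ k))
    where
    vanish : ∀ τs → concatMap (∂-at e i) τs ≡ []
    vanish []       = refl
    vanish (_ ∷ τs) rewrite eq = vanish τs
  ... | suc j = begin
    multiplicity m (monomials (termMulℕ (k * suc j , v) (g i)))
      ≡⟨ cong (multiplicity m) (List.concatMap-map _ _ (g i)) ⟩
    multiplicity m (concatMap (λ (c , h) → replicate (k * suc j * c) (v ⊕ h)) (g i))
      ≡⟨ multiplicity-concatMap-scale m k _ (∂-at e i) scale (g i) ⟩
    k * multiplicity m (concatMap (∂-at e i) (g i)) ∎
    where
    open ≡-Reasoning
    v = updateAt e i (λ _ → j)
    *-reassoc : ∀ k s c d → k * s * c * d ≡ k * (s * c * d)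
    *-reassoc = solve-∀
    scale : ∀ τ → multiplicity m (replicate (k * suc j * proj₁ τ) (v ⊕ proj₂ τ)) ≡ k * multiplicity m (∂-at e i τ)
    scale (c , h) rewrite multiplicity-replicate m (k * suc j * c) (v ⊕ h)
                        | multiplicity-replicate m (lookup e i * c) (updateAt e i pred ⊕ h)
                        | eq | Vec.updateAt-cong-local i {f = pred} {g = λ _ → j} e (cong pred eq)
                        = *-reassoc k (suc j) c (δ (v ⊕ h) m)

  multiplicity-Derℕ : ∀ m P → multiplicity m (monomials (Derℕ P)) ≡ multiplicity m (concatMap ∂ (monomials P))
  multiplicity-Derℕ m []            = refl
  multiplicity-Derℕ m ((k , e) ∷ P) = begin
    multiplicity m (monomials (D ++ Derℕ P))
      ≡⟨ cong (multiplicity m) (monomials-++ D _) ⟩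
    multiplicity m (monomials D ++ monomials (Derℕ P))
      ≡⟨ multiplicity-++ m (monomials D) _ ⟩
    multiplicity m (monomials D) + multiplicity m (monomials (Derℕ P))
      ≡⟨ cong₂ _+_ (trans (cong (multiplicity m) (monomials-concatMap (derivTermAtℕ (k , e)) (allFin 5)))
                          (multiplicity-concatMap-scale m k (monomials ∘ derivTermAtℕ (k , e)) (λ i → concatMap (∂-at e i) (g i))
                                                         (multiplicity-derivTermAt m k e) (allFin 5)))
                   (multiplicity-Derℕ m P) ⟩
    k * multiplicity m (∂ e) + multiplicity m (concatMap ∂ (monomials P))
      ≡⟨ cong (_+ _) (multiplicity-copies m k (∂ e)) ⟨
    multiplicity m (copies k (∂ e)) + multiplicity m (concatMap ∂ (monomials P))
      ≡⟨ multiplicity-++ m (copies k (∂ e)) _ ⟨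
    multiplicity m (copies k (∂ e) ++ concatMap ∂ (monomials P))
      ≡⟨ cong (λ xs → multiplicity m (xs ++ _)) (concatMap-replicate ∂ k e) ⟨
    multiplicity m (concatMap ∂ (replicate k e) ++ concatMap ∂ (monomials P))
      ≡⟨ cong (multiplicity m) (List.concatMap-++ ∂ (replicate k e) _) ⟨
    multiplicity m (concatMap ∂ (replicate k e ++ monomials P)) ∎
    where
    open ≡-Reasoning
    D = concatMap (derivTermAtℕ (k , e)) (allFin 5)

  monomials-Derℕ : ∀ P → monomials (Derℕ P) ↭ concatMap ∂ (monomials P)
  monomials-Derℕ P = ↭-fromMultiplicities _ _ (λ m → multiplicity-Derℕ m P)

  ∂-at-⊕ : ∀ x y i τ → ∂-at (x ⊕ y) i τ ≡ map (_⊕ y) (∂-at x i τ) ++ map (x ⊕_) (∂-at y i τ)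
  ∂-at-⊕ x y i (c , h) = begin
    replicate (lookup (x ⊕ y) i * c) w
      ≡⟨ cong (λ n → replicate (n * c) w) (Vec.lookup-zipWith _+_ i x y) ⟩
    replicate ((lookup x i + lookup y i) * c) w
      ≡⟨ cong (λ n → replicate n w) (ℕ.*-distribʳ-+ c (lookup x i) (lookup y i)) ⟩
    replicate (lookup x i * c + lookup y i * c) w
      ≡⟨ replicate-+ (lookup x i * c) _ w ⟩
    replicate (lookup x i * c) w ++ replicate (lookup y i * c) w
      ≡⟨ cong₂ _++_ (replicate-*-cong (lookup x i) c w≡ˡ) (replicate-*-cong (lookup y i) c w≡ʳ) ⟩
    replicate (lookup x i * c) ((updateAt x i pred ⊕ h) ⊕ y) ++ replicate (lookup y i * c) (x ⊕ updateAt y i pred ⊕ h)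
      ≡⟨ cong₂ _++_ (List.map-replicate (_⊕ y) (lookup x i * c) _) (List.map-replicate (x ⊕_) (lookup y i * c) _) ⟨
    map (_⊕ y) (∂-at x i (c , h)) ++ map (x ⊕_) (∂-at y i (c , h)) ∎
    where
    open ≡-Reasoning
    w = updateAt (x ⊕ y) i pred ⊕ h
    w≡ˡ : lookup x i ≢ 0 → w ≡ (updateAt x i pred ⊕ h) ⊕ y
    w≡ˡ xᵢ≢0 = begin
      updateAt (x ⊕ y) i pred ⊕ h   ≡⟨ cong (_⊕ h) (updateAt-pred-⊕ˡ x y i xᵢ≢0) ⟩
      (updateAt x i pred ⊕ y) ⊕ h   ≡⟨ ⊕-assoc _ y h ⟩
      updateAt x i pred ⊕ (y ⊕ h)   ≡⟨ cong (updateAt x i pred ⊕_) (⊕-comm y h) ⟩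
      updateAt x i pred ⊕ (h ⊕ y)   ≡⟨ ⊕-assoc _ h y ⟨
      (updateAt x i pred ⊕ h) ⊕ y   ∎
    w≡ʳ : lookup y i ≢ 0 → w ≡ x ⊕ updateAt y i pred ⊕ h
    w≡ʳ yᵢ≢0 = trans (cong (_⊕ h) (updateAt-pred-⊕ʳ x y i yᵢ≢0)) (⊕-assoc x _ h)

  map-∂ : ∀ (f : Mono → Mono) x → map f (∂ x) ≡ concatMap (λ i → concatMap (map f ∘ ∂-at x i) (g i)) (allFin 5)
  map-∂ f x = trans (List.map-concatMap f (λ i → concatMap (∂-at x i) (g i)) (allFin 5))
                    (List.concatMap-cong (λ i → List.map-concatMap f (∂-at x i) (g i)) (allFin 5))

  ∂-⊕ : ∀ x y → ∂ (x ⊕ y) ↭ map (_⊕ y) (∂ x) ++ map (x ⊕_) (∂ y)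
  ∂-⊕ x y = begin
    ∂ (x ⊕ y)
      ≡⟨ List.concatMap-cong (λ i → List.concatMap-cong (∂-at-⊕ x y i) (g i)) (allFin 5) ⟩
    concatMap (λ i → concatMap (λ τ → L i τ ++ R i τ) (g i)) (allFin 5)
      ↭⟨ concatMap-cong-local-↭ (allFin 5) (λ {i} _ → concatMap-++-↭ (L i) (R i) (g i)) ⟩
    concatMap (λ i → concatMap (L i) (g i) ++ concatMap (R i) (g i)) (allFin 5)
      ↭⟨ concatMap-++-↭ (λ i → concatMap (L i) (g i)) (λ i → concatMap (R i) (g i)) (allFin 5) ⟩
    concatMap (λ i → concatMap (L i) (g i)) (allFin 5) ++ concatMap (λ i → concatMap (R i) (g i)) (allFin 5)
      ≡⟨ cong₂ _++_ (map-∂ (_⊕ y) x) (map-∂ (x ⊕_) y) ⟨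
    map (_⊕ y) (∂ x) ++ map (x ⊕_) (∂ y) ∎
    where
    open PermutationReasoning
    L R : Fin 5 → ℕ × Mono → List Mono
    L i τ = map (_⊕ y) (∂-at x i τ)
    R i τ = map (x ⊕_) (∂-at y i τ)

-- Binary trees and Rémy's growth

grammarℕ : Fin 5 → ℕPoly
grammarℕ zero                         = (3 , mono 1 0 0 1 1) ∷ (3 , mono 0 1 1 0 1) ∷ []
grammarℕ (suc zero)                   = (3 , mono 1 0 0 1 1) ∷ (3 , mono 0 1 1 0 1) ∷ []
grammarℕ (suc (suc zero))             = (2 , mono 1 0 0 0 0) ∷ []
grammarℕ (suc (suc (suc zero)))       = (2 , mono 0 1 0 0 0) ∷ []
grammarℕ (suc (suc (suc (suc zero)))) = (1 , mono 0 0 1 0 2) ∷ (1 , mono 0 0 0 1 2) ∷ []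

grammar-embed : ∀ i → grammar i ≡ embed (grammarℕ i)
grammar-embed zero                         = refl
grammar-embed (suc zero)                   = refl
grammar-embed (suc (suc zero))             = refl
grammar-embed (suc (suc (suc zero)))       = refl
grammar-embed (suc (suc (suc (suc zero)))) = refl

open ℕDerivative grammarℕ

𝐚 𝐛 𝐭 𝐜𝐭 𝐝𝐭 : Mono
𝐚  = mono 1 0 0 0 0
𝐛  = mono 0 1 0 0 0
𝐭  = mono 0 0 0 0 1
𝐜𝐭 = mono 0 0 1 0 1
𝐝𝐭 = mono 0 0 0 1 1

∂𝐭 : 𝐝𝐭 ⊕ 𝐭 ∷ 𝐜𝐭 ⊕ 𝐭 ∷ [] ↭ ∂ 𝐭
∂𝐭 = isPermutation-sound _ _ _

∂𝐜𝐭 : 𝐝𝐭 ⊕ 𝐜𝐭 ∷ 𝐜𝐭 ⊕ 𝐜𝐭 ∷ 𝐭 ⊕ 𝐚 ∷ 𝐭 ⊕ 𝐚 ∷ [] ↭ ∂ 𝐜𝐭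
∂𝐜𝐭 = isPermutation-sound _ _ _

∂𝐝𝐭 : 𝐝𝐭 ⊕ 𝐝𝐭 ∷ 𝐜𝐭 ⊕ 𝐝𝐭 ∷ 𝐭 ⊕ 𝐛 ∷ 𝐭 ⊕ 𝐛 ∷ [] ↭ ∂ 𝐝𝐭
∂𝐝𝐭 = isPermutation-sound _ _ _

-- A binary tree encodes a plane forest: `fork l r` is a vertex whose children form the forest `l`
-- and whose elder (left) siblings form the forest `r` (see `forest` below), and its slot says
-- whether it is the youngest child of its parent.  `localWeight` accounts for the vertex and the
-- edge above it: a, b, c for singleton, elder and young leaves, t for a young edge, and d for a
-- young interior parent, charged to that parent's eldest child.
data Bin : Set where
  leaf : Bin
  fork : Bin → Bin → Bin

data Slot : Set where
  last earlier : Slot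

localWeight : Slot → Bin → Bin → Mono
localWeight s       (fork _ _) leaf       = 𝐝𝐭
localWeight s       (fork _ _) (fork _ _) = 𝐭
localWeight s       leaf       (fork _ _) = 𝐜𝐭
localWeight last    leaf       leaf       = 𝐚
localWeight earlier leaf       leaf       = 𝐛

weightB : Slot → Bin → Mono
weightB s leaf       = 0ᵥ
weightB s (fork l r) = localWeight s l r ⊕ weightB last l ⊕ weightB earlier r

-- Rémy's growth, without labels: a tree with n forks has 4n + 2 growths.
grow growInside : Bin → List Bin
grow t = fork t leaf ∷ fork leaf t ∷ growInside t
growInside leaf       = []
growInside (fork l r) = map (λ l′ → fork l′ r) (grow l) ++ map (fork l) (grow r)

map-grow-cong : ∀ {f h : Bin → B} → (∀ l r → f (fork l r) ≡ h (fork l r)) → ∀ t → map f (grow t) ≡ map h (grow t)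
map-grow-cong {f = f} {h} f≡h t = cong₂ _∷_ (f≡h t leaf) (cong₂ _∷_ (f≡h leaf t) (inside t))
  where
  under : ∀ (ctx : Bin → Bin) → (∀ u → f (ctx u) ≡ h (ctx u)) → ∀ us → map f (map ctx us) ≡ map h (map ctx us)
  under ctx eq us = trans (sym (List.map-∘ us)) (trans (List.map-cong eq us) (List.map-∘ us))
  inside : ∀ t → map f (growInside t) ≡ map h (growInside t)
  inside leaf       = refl
  inside (fork l r) = begin
    map f (map (λ l′ → fork l′ r) (grow l) ++ map (fork l) (grow r))
      ≡⟨ List.map-++ f (map (λ l′ → fork l′ r) (grow l)) _ ⟩
    map f (map (λ l′ → fork l′ r) (grow l)) ++ map f (map (fork l) (grow r))
      ≡⟨ cong₂ _++_ (under (λ l′ → fork l′ r) (λ l′ → f≡h l′ r) (grow l)) (under (fork l) (f≡h l) (grow r)) ⟩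
    map h (map (λ l′ → fork l′ r) (grow l)) ++ map h (map (fork l) (grow r))
      ≡⟨ List.map-++ h (map (λ l′ → fork l′ r) (grow l)) _ ⟨
    map h (map (λ l′ → fork l′ r) (grow l) ++ map (fork l) (grow r)) ∎
    where open ≡-Reasoning

growing-weights : ∀ (ctx : Bin → Bin) (h : Mono → Mono) s s′ → (∀ l r → weightB s (ctx (fork l r)) ≡ h (weightB s′ (fork l r))) →
                  ∀ t → map (weightB s) (map ctx (grow t)) ≡ map h (map (weightB s′) (grow t))
growing-weights ctx h s s′ eq t = trans (sym (List.map-∘ (grow t))) (trans (map-grow-cong eq t) (List.map-∘ (grow t)))

weight-fork-leaf : ∀ s l r → weightB s (fork (fork l r) leaf) ≡ 𝐝𝐭 ⊕ weightB last (fork l r)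
weight-fork-leaf s l r = cong (𝐝𝐭 ⊕_) (⊕-identityʳ _)

weight-leaf-fork : ∀ s l r → weightB s (fork leaf (fork l r)) ≡ 𝐜𝐭 ⊕ weightB earlier (fork l r)
weight-leaf-fork s l r = cong (𝐜𝐭 ⊕_) (⊕-identityˡ _)

leibniz : ∀ μ x {us vs} → us ↭ map (_⊕ x) (∂ μ) → vs ↭ map (μ ⊕_) (∂ x) → us ++ vs ↭ ∂ (μ ⊕ x)
leibniz μ x us↭ vs↭ = ↭-trans (↭.++⁺ us↭ vs↭) (↭-sym (∂-⊕ μ x))

weights-grow : ∀ s l r → map (weightB s) (grow (fork l r)) ↭ ∂ (weightB s (fork l r))
weights-grow-fork-fork : ∀ s l₁ l₂ r₁ r₂ → let t = fork (fork l₁ l₂) (fork r₁ r₂) in map (weightB s) (grow t) ↭ ∂ (weightB s t)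
weights-grow-leaf-fork : ∀ s r₁ r₂ → let t = fork leaf (fork r₁ r₂) in map (weightB s) (grow t) ↭ ∂ (weightB s t)
weights-grow-fork-leaf : ∀ s l₁ l₂ → let t = fork (fork l₁ l₂) leaf in map (weightB s) (grow t) ↭ ∂ (weightB s t)

weights-grow last    leaf         leaf         = isPermutation-sound _ _ _
weights-grow earlier leaf         leaf         = isPermutation-sound _ _ _
weights-grow s       (fork l₁ l₂) (fork r₁ r₂) = weights-grow-fork-fork s l₁ l₂ r₁ r₂
weights-grow s       leaf         (fork r₁ r₂) = weights-grow-leaf-fork s r₁ r₂
weights-grow s       (fork l₁ l₂) leaf         = weights-grow-fork-leaf s l₁ l₂

weights-grow-fork-fork s l₁ l₂ r₁ r₂ = leibniz 𝐭 x (↭-trans (↭-reflexive roots) (↭.map⁺ (_⊕ x) ∂𝐭)) (begin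
  map (weightB s) (map (λ l′ → fork l′ r) (grow l) ++ map (fork l) (grow r))
    ≡⟨ trans (List.map-++ (weightB s) (map (λ l′ → fork l′ r) (grow l)) (map (fork l) (grow r))) (cong₂ _++_
         (growing-weights (λ l′ → fork l′ r) (λ v → 𝐭 ⊕ v ⊕ wr) s last (λ _ _ → refl) l)
         (growing-weights (fork l) (λ v → 𝐭 ⊕ wl ⊕ v) s earlier (λ _ _ → refl) r)) ⟩
  map (λ v → 𝐭 ⊕ v ⊕ wr) (map (weightB last) (grow l)) ++ map (λ v → 𝐭 ⊕ wl ⊕ v) (map (weightB earlier) (grow r))
    ↭⟨ ↭.++⁺ (↭.map⁺ (λ v → 𝐭 ⊕ v ⊕ wr) (weights-grow last l₁ l₂))
             (↭.map⁺ (λ v → 𝐭 ⊕ wl ⊕ v) (weights-grow earlier r₁ r₂)) ⟩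
  map (λ v → 𝐭 ⊕ v ⊕ wr) (∂ wl) ++ map (λ v → 𝐭 ⊕ wl ⊕ v) (∂ wr)
    ≡⟨ trans (cong₂ _++_ (List.map-∘ {g = 𝐭 ⊕_} (∂ wl)) (List.map-∘ {g = 𝐭 ⊕_} (∂ wr)))
             (sym (List.map-++ (𝐭 ⊕_) (map (_⊕ wr) (∂ wl)) (map (wl ⊕_) (∂ wr)))) ⟩
  map (𝐭 ⊕_) (map (_⊕ wr) (∂ wl) ++ map (wl ⊕_) (∂ wr))
    ↭⟨ ↭.map⁺ (𝐭 ⊕_) (↭-sym (∂-⊕ wl wr)) ⟩
  map (𝐭 ⊕_) (∂ x) ∎)
  where
  open PermutationReasoning
  l = fork l₁ l₂
  r = fork r₁ r₂
  wl = weightB last l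
  wr = weightB earlier r
  x = wl ⊕ wr
  roots : weightB s (fork (fork l r) leaf) ∷ weightB s (fork leaf (fork l r)) ∷ [] ≡ map (_⊕ x) (𝐝𝐭 ⊕ 𝐭 ∷ 𝐜𝐭 ⊕ 𝐭 ∷ [])
  roots = cong₂ _∷_ (trans (weight-fork-leaf s l r) (sym (⊕-assoc 𝐝𝐭 𝐭 x)))
                    (cong₂ _∷_ (trans (weight-leaf-fork s l r) (sym (⊕-assoc 𝐜𝐭 𝐭 x))) refl)

weights-grow-leaf-fork s r₁ r₂ = ↭-trans (leibniz 𝐜𝐭 x (↭-trans (↭-reflexive roots) (↭.map⁺ (_⊕ x) ∂𝐜𝐭)) (begin
  map (weightB s) (map (fork leaf) (grow r))    ≡⟨ growing-weights (fork leaf) (𝐜𝐭 ⊕_) s earlier (weight-leaf-fork s) r ⟩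
  map (𝐜𝐭 ⊕_) (map (weightB earlier) (grow r))  ↭⟨ ↭.map⁺ (𝐜𝐭 ⊕_) (weights-grow earlier r₁ r₂) ⟩
  map (𝐜𝐭 ⊕_) (∂ x)                             ∎))
  (↭-reflexive (cong ∂ (sym (weight-leaf-fork s r₁ r₂))))
  where
  open PermutationReasoning
  r = fork r₁ r₂
  x = weightB earlier r
  roots : weightB s (fork (fork leaf r) leaf) ∷ weightB s (fork leaf (fork leaf r)) ∷
          weightB s (fork (fork leaf leaf) r) ∷ weightB s (fork (fork leaf leaf) r) ∷ []
        ≡ map (_⊕ x) (𝐝𝐭 ⊕ 𝐜𝐭 ∷ 𝐜𝐭 ⊕ 𝐜𝐭 ∷ 𝐭 ⊕ 𝐚 ∷ 𝐭 ⊕ 𝐚 ∷ [])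
  roots = cong₂ _∷_ (trans (weight-fork-leaf s leaf r) (trans (cong (𝐝𝐭 ⊕_) (weight-leaf-fork last r₁ r₂)) (sym (⊕-assoc 𝐝𝐭 𝐜𝐭 x))))
         (cong₂ _∷_ (trans (weight-leaf-fork s leaf r) (trans (cong (𝐜𝐭 ⊕_) (weight-leaf-fork earlier r₁ r₂)) (sym (⊕-assoc 𝐜𝐭 𝐜𝐭 x))))
         (cong₂ _∷_ (sym (⊕-assoc 𝐭 𝐚 x)) (cong₂ _∷_ (sym (⊕-assoc 𝐭 𝐚 x)) refl)))

weights-grow-fork-leaf s l₁ l₂ = ↭-trans (begin
  wˢ (fork t leaf) ∷ wˢ (fork leaf t) ∷ map wˢ (map (λ l′ → fork l′ leaf) (grow l) ++ map (fork l) (grow leaf))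
    ≡⟨ cong (λ ws → wˢ (fork t leaf) ∷ wˢ (fork leaf t) ∷ ws) (List.map-++ wˢ (map (λ l′ → fork l′ leaf) (grow l)) _) ⟩
  wˢ (fork t leaf) ∷ wˢ (fork leaf t) ∷ (inner ++ wˢ (fork l (fork leaf leaf)) ∷ wˢ (fork l (fork leaf leaf)) ∷ [])
    ↭⟨ ↭.++⁺ˡ (wˢ (fork t leaf) ∷ wˢ (fork leaf t) ∷ []) (↭.++-comm inner _) ⟩
  wˢ (fork t leaf) ∷ wˢ (fork leaf t) ∷ wˢ (fork l (fork leaf leaf)) ∷ wˢ (fork l (fork leaf leaf)) ∷ inner
    ↭⟨ leibniz 𝐝𝐭 x (↭-trans (↭-reflexive roots) (↭.map⁺ (_⊕ x) ∂𝐝𝐭)) (begin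
         inner                                      ≡⟨ growing-weights (λ l′ → fork l′ leaf) (𝐝𝐭 ⊕_) s last (weight-fork-leaf s) l ⟩
         map (𝐝𝐭 ⊕_) (map (weightB last) (grow l))  ↭⟨ ↭.map⁺ (𝐝𝐭 ⊕_) (weights-grow last l₁ l₂) ⟩
         map (𝐝𝐭 ⊕_) (∂ x)                          ∎) ⟩
  ∂ (𝐝𝐭 ⊕ x) ∎)
  (↭-reflexive (cong ∂ (sym (weight-fork-leaf s l₁ l₂))))
  where
  open PermutationReasoning
  wˢ = weightB s
  l = fork l₁ l₂
  t = fork l leaf
  x = weightB last l
  inner = map wˢ (map (λ l′ → fork l′ leaf) (grow l))
  roots : wˢ (fork t leaf) ∷ wˢ (fork leaf t) ∷ wˢ (fork l (fork leaf leaf)) ∷ wˢ (fork l (fork leaf leaf)) ∷ []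
        ≡ map (_⊕ x) (𝐝𝐭 ⊕ 𝐝𝐭 ∷ 𝐜𝐭 ⊕ 𝐝𝐭 ∷ 𝐭 ⊕ 𝐛 ∷ 𝐭 ⊕ 𝐛 ∷ [])
  roots = cong₂ _∷_ (trans (weight-fork-leaf s l leaf) (trans (cong (𝐝𝐭 ⊕_) (weight-fork-leaf last l₁ l₂)) (sym (⊕-assoc 𝐝𝐭 𝐝𝐭 x))))
         (cong₂ _∷_ (trans (weight-leaf-fork s l leaf) (trans (cong (𝐜𝐭 ⊕_) (weight-fork-leaf earlier l₁ l₂)) (sym (⊕-assoc 𝐜𝐭 𝐝𝐭 x))))
         (cong₂ _∷_ t⊕x⊕b (cong₂ _∷_ t⊕x⊕b refl)))
    where
    t⊕x⊕b : 𝐭 ⊕ x ⊕ 𝐛 ≡ (𝐭 ⊕ 𝐛) ⊕ x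
    t⊕x⊕b = trans (cong (𝐭 ⊕_) (⊕-comm x 𝐛)) (sym (⊕-assoc 𝐭 𝐛 x))

-- Counting growths

_≟ᵇ_ : DecidableEquality Bin
leaf     ≟ᵇ leaf       = yes refl
leaf     ≟ᵇ fork _ _   = no λ ()
fork _ _ ≟ᵇ leaf       = no λ ()
fork a b ≟ᵇ fork c d with a ≟ᵇ c | b ≟ᵇ d
... | yes refl | yes refl = yes refl
... | no  a≢c  | _        = no λ { refl → a≢c refl }
... | yes _    | no  b≢d  = no λ { refl → b≢d refl }

module Trees = Multiset _≟ᵇ_
open Trees using () renaming (multiplicity to #; δ to δᵇ; δ-sym to δᵇ-sym; multiplicity-++ to #-++)

size : Bin → ℕ
size leaf       = 0
size (fork l r) = suc (size l + size r)

whenLeaf : Bin → Bin → List Bin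
whenLeaf leaf       u = [ u ]
whenLeaf (fork _ _) u = []

-- `prune u` lists the trees that grow into u, with multiplicity (`#-grow`).
prune : Bin → List Bin
prune leaf       = []
prune (fork l r) = whenLeaf r l ++ whenLeaf l r ++ map (λ l′ → fork l′ r) (prune l) ++ map (fork l) (prune r)

δᵇ-fork : ∀ a b c d → δᵇ (fork a b) (fork c d) ≡ δᵇ a c * δᵇ b d
δᵇ-fork a b c d with a ≟ᵇ c | b ≟ᵇ d
... | yes refl | yes refl = refl
... | no  _    | _        = refl
... | yes refl | no  _    = refl

#-map-forkˡ : ∀ r a b xs → # (fork a b) (map (λ x → fork x r) xs) ≡ δᵇ r b * # a xs
#-map-forkˡ r a b []       = sym (ℕ.*-zeroʳ (δᵇ r b))
#-map-forkˡ r a b (x ∷ xs) = begin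
  δᵇ (fork x r) (fork a b) + # (fork a b) (map (λ x → fork x r) xs) ≡⟨ cong₂ _+_ (δᵇ-fork x r a b) (#-map-forkˡ r a b xs) ⟩
  δᵇ x a * δᵇ r b + δᵇ r b * # a xs                                    ≡⟨ cong (_+ δᵇ r b * # a xs) (ℕ.*-comm (δᵇ x a) (δᵇ r b)) ⟩
  δᵇ r b * δᵇ x a + δᵇ r b * # a xs                                    ≡⟨ ℕ.*-distribˡ-+ (δᵇ r b) (δᵇ x a) _ ⟨
  δᵇ r b * (δᵇ x a + # a xs)                                          ∎
  where open ≡-Reasoning

#-map-forkʳ : ∀ l a b xs → # (fork a b) (map (fork l) xs) ≡ δᵇ l a * # b xs
#-map-forkʳ l a b []       = sym (ℕ.*-zeroʳ (δᵇ l a))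
#-map-forkʳ l a b (x ∷ xs) = begin
  δᵇ (fork l x) (fork a b) + # (fork a b) (map (fork l) xs) ≡⟨ cong₂ _+_ (δᵇ-fork l x a b) (#-map-forkʳ l a b xs) ⟩
  δᵇ l a * δᵇ x b + δᵇ l a * # b xs                            ≡⟨ ℕ.*-distribˡ-+ (δᵇ l a) (δᵇ x b) _ ⟨
  δᵇ l a * (δᵇ x b + # b xs)                                  ∎
  where open ≡-Reasoning

#-leaf-map : ∀ (f : Bin → Bin) → (∀ x → f x ≢ leaf) → ∀ xs → # leaf (map f xs) ≡ 0
#-leaf-map f f≢leaf []       = refl
#-leaf-map f f≢leaf (x ∷ xs) = cong₂ _+_ (Trees.δ-≢ (f≢leaf x)) (#-leaf-map f f≢leaf xs)

#-whenLeaf : ∀ t u v → # t (whenLeaf u v) ≡ δᵇ leaf u * δᵇ v t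
#-whenLeaf t leaf       v = refl
#-whenLeaf t (fork _ _) v = refl

#-grow : ∀ t u → # u (grow t) ≡ # t (prune u)
#-grow leaf       leaf = refl
#-grow (fork l r) leaf = trans (#-++ leaf (map (λ l′ → fork l′ r) (grow l)) _)
  (cong₂ _+_ (#-leaf-map (λ x → fork x r) (λ _ ()) (grow l)) (#-leaf-map (fork l) (λ _ ()) (grow r)))
#-grow t (fork l′ r′) = begin
  δᵇ (fork t leaf) u + (δᵇ (fork leaf t) u + # u (growInside t))
    ≡⟨ cong₂ _+_ (trans (δᵇ-fork t leaf l′ r′) (trans (ℕ.*-comm (δᵇ t l′) _) (cong (δᵇ leaf r′ *_) (δᵇ-sym t l′))))
                 (cong₂ _+_ (trans (δᵇ-fork leaf t l′ r′) (cong (δᵇ leaf l′ *_) (δᵇ-sym t r′))) (inside t)) ⟩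
  δᵇ leaf r′ * δᵇ l′ t + (δᵇ leaf l′ * δᵇ r′ t + (# t (map (λ x → fork x r′) (prune l′)) + # t (map (fork l′) (prune r′))))
    ≡⟨ cong₂ _+_ (#-whenLeaf t r′ l′) (cong₂ _+_ (#-whenLeaf t l′ r′) (#-++ t (map (λ x → fork x r′) (prune l′)) _)) ⟨
  # t (whenLeaf r′ l′) + (# t (whenLeaf l′ r′) + # t (map (λ x → fork x r′) (prune l′) ++ map (fork l′) (prune r′)))
    ≡⟨ trans (#-++ t (whenLeaf r′ l′) _) (cong (# t (whenLeaf r′ l′) +_) (#-++ t (whenLeaf l′ r′) _)) ⟨
  # t (prune u) ∎
  where
  open ≡-Reasoning
  u = fork l′ r′
  inside : ∀ t → # u (growInside t) ≡ # t (map (λ x → fork x r′) (prune l′)) + # t (map (fork l′) (prune r′))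
  inside leaf       = sym (cong₂ _+_ (#-leaf-map (λ x → fork x r′) (λ _ ()) (prune l′)) (#-leaf-map (fork l′) (λ _ ()) (prune r′)))
  inside (fork l r) = begin
    # u (map (λ x → fork x r) (grow l) ++ map (fork l) (grow r))
      ≡⟨ #-++ u (map (λ x → fork x r) (grow l)) _ ⟩
    # u (map (λ x → fork x r) (grow l)) + # u (map (fork l) (grow r))
      ≡⟨ cong₂ _+_ (#-map-forkˡ r l′ r′ (grow l)) (#-map-forkʳ l l′ r′ (grow r)) ⟩
    δᵇ r r′ * # l′ (grow l) + δᵇ l l′ * # r′ (grow r)
      ≡⟨ cong₂ _+_ (cong₂ _*_ (δᵇ-sym r r′) (#-grow l l′)) (cong₂ _*_ (δᵇ-sym l l′) (#-grow r r′)) ⟩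
    δᵇ r′ r * # l (prune l′) + δᵇ l′ l * # r (prune r′)
      ≡⟨ cong₂ _+_ (#-map-forkˡ r′ l r (prune l′)) (#-map-forkʳ l′ l r (prune r′)) ⟨
    # (fork l r) (map (λ x → fork x r′) (prune l′)) + # (fork l r) (map (fork l′) (prune r′)) ∎

size-prune : ∀ t → All (λ y → suc (size y) ≡ size t) (prune t)
size-prune leaf       = []
size-prune (fork l r) = All.++⁺ (whenLeafʳ r) (All.++⁺ (whenLeafˡ l) (All.++⁺
  (All.map⁺ (All.map (cong (λ n → suc (n + size r))) (size-prune l)))
  (All.map⁺ (All.map (λ {y} eq → cong suc (trans (sym (ℕ.+-suc (size l) (size y))) (cong (size l +_) eq))) (size-prune r)))))
  where
  whenLeafʳ : ∀ r → All (λ y → suc (size y) ≡ size (fork l r)) (whenLeaf r l)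
  whenLeafʳ leaf       = cong suc (sym (ℕ.+-identityʳ (size l))) ∷ []
  whenLeafʳ (fork _ _) = []
  whenLeafˡ : ∀ l → All (λ y → suc (size y) ≡ size (fork l r)) (whenLeaf l r)
  whenLeafˡ leaf       = refl ∷ []
  whenLeafˡ (fork _ _) = []

length-prune : ∀ l r → length (prune (fork l r)) ≡ suc (size (fork l r))
length-prune l r = begin
  length (whenLeaf r l ++ whenLeaf l r ++ map (λ l′ → fork l′ r) (prune l) ++ map (fork l) (prune r))
    ≡⟨ trans (List.length-++ (whenLeaf r l)) (cong (length (whenLeaf r l) +_) (trans (List.length-++ (whenLeaf l r))
        (cong (length (whenLeaf l r) +_) (trans (List.length-++ (map (λ l′ → fork l′ r) (prune l)))
          (cong₂ _+_ (List.length-map _ (prune l)) (List.length-map _ (prune r))))))) ⟩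
  length (whenLeaf r l) + (length (whenLeaf l r) + (length (prune l) + length (prune r)))
    ≡⟨ regroup (length (whenLeaf r l)) (length (whenLeaf l r)) (length (prune l)) (length (prune r)) ⟩
  (length (whenLeaf l r) + length (prune l)) + (length (whenLeaf r l) + length (prune r))
    ≡⟨ cong₂ _+_ (pruned l r) (pruned r l) ⟩
  suc (size l) + suc (size r)
    ≡⟨ cong suc (ℕ.+-suc (size l) (size r)) ⟩
  suc (size (fork l r)) ∎
  where
  open ≡-Reasoning
  regroup : ∀ a b c d → a + (b + (c + d)) ≡ (b + c) + (a + d)
  regroup = solve-∀
  pruned : ∀ t u → length (whenLeaf t u) + length (prune t) ≡ suc (size t)
  pruned leaf       u = refl
  pruned (fork l r) u = length-prune l r

fork-injective : ∀ {a b c d} → fork a c ≡ fork b d → a ≡ b × c ≡ d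
fork-injective refl = refl , refl

treesUpTo : ℕ → List Bin
treesUpTo zero    = [ leaf ]
treesUpTo (suc n) = leaf ∷ filter (λ t → size t ≤? suc n) (cartesianProductWith fork (treesUpTo n) (treesUpTo n))

∈-treesUpTo⁺ : ∀ n {t} → size t ≤ n → t ∈ treesUpTo n
∈-treesUpTo⁺ zero    {leaf}     _ = here refl
∈-treesUpTo⁺ (suc n) {leaf}     _ = here refl
∈-treesUpTo⁺ (suc n) {fork l r} (s≤s sl+sr≤n) = there (∈-filter⁺ (λ t → size t ≤? suc n)
  (∈-cartesianProductWith⁺ fork (∈-treesUpTo⁺ n (ℕ.m+n≤o⇒m≤o (size l) sl+sr≤n)) (∈-treesUpTo⁺ n (ℕ.m+n≤o⇒n≤o (size l) sl+sr≤n)))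
  (s≤s sl+sr≤n))

∈-treesUpTo⁻ : ∀ n {t} → t ∈ treesUpTo n → size t ≤ n
∈-treesUpTo⁻ zero    (here refl) = z≤n
∈-treesUpTo⁻ (suc n) (here refl) = z≤n
∈-treesUpTo⁻ (suc n) (there t∈) = proj₂ (∈-filter⁻ (λ t → size t ≤? suc n) {xs = cartesianProductWith fork (treesUpTo n) (treesUpTo n)} t∈)

treesUpTo-unique : ∀ n → Unique (treesUpTo n)
treesUpTo-unique zero    = [] ∷ []
treesUpTo-unique (suc n) = All.tabulate leaf∉ ∷ Unique.filter⁺ (λ t → size t ≤? suc n)
  (Unique.cartesianProductWith⁺ fork fork-injective (treesUpTo-unique n) (treesUpTo-unique n))
  where
  leaf∉ : ∀ {t} → t ∈ filter (λ t → size t ≤? suc n) (cartesianProductWith fork (treesUpTo n) (treesUpTo n)) → leaf ≢ t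
  leaf∉ t∈ refl with ∈-cartesianProductWith⁻ fork (treesUpTo n) (treesUpTo n) (proj₁ (∈-filter⁻ (λ t → size t ≤? suc n) t∈))
  ... | _ , _ , _ , _ , ()

treesOfSize : ℕ → List Bin
treesOfSize n = filter (λ t → size t ≟ n) (treesUpTo n)

treesOfSize-unique : ∀ n → Unique (treesOfSize n)
treesOfSize-unique n = Unique.filter⁺ (λ t → size t ≟ n) (treesUpTo-unique n)

∈-treesOfSize : ∀ n t → t ∈ treesOfSize n ⇔ size t ≡ n
∈-treesOfSize n t = mk⇔ (proj₂ ∘ ∈-filter⁻ (λ t → size t ≟ n) {xs = treesUpTo n})
                        (λ { refl → ∈-filter⁺ (λ t → size t ≟ n) (∈-treesUpTo⁺ n ℕ.≤-refl) refl })

#-treesOfSize-≡ : ∀ {n t} → size t ≡ n → # t (treesOfSize n) ≡ 1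
#-treesOfSize-≡ {n} {t} st≡n = Trees.multiplicity-∈-unique (treesOfSize-unique n) (Equivalence.from (∈-treesOfSize n t) st≡n)

#-treesOfSize-≢ : ∀ {n t} → size t ≢ n → # t (treesOfSize n) ≡ 0
#-treesOfSize-≢ {n} {t} st≢n = Trees.multiplicity-∉ (treesOfSize n) (st≢n ∘ Equivalence.to (∈-treesOfSize n t))

grow-treesOfSize : ∀ n → concatMap grow (treesOfSize n) ↭ copies (2 + n) (treesOfSize (suc n))
grow-treesOfSize n = Trees.↭-fromMultiplicities _ _ λ u → begin
  # u (concatMap grow Sₙ)                       ≡⟨ Trees.multiplicity-concatMap u grow Sₙ ⟩
  sum (map (λ t → # u (grow t)) Sₙ)             ≡⟨ cong sum (List.map-cong (λ t → #-grow t u) Sₙ) ⟩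
  sum (map (λ t → # t (prune u)) Sₙ)            ≡⟨ Trees.sum-multiplicity-comm Sₙ (prune u) ⟩
  sum (map (λ y → # y Sₙ) (prune u))            ≡⟨ pruned u ⟩
  (2 + n) * # u (treesOfSize (suc n))          ≡⟨ Trees.multiplicity-copies u (2 + n) (treesOfSize (suc n)) ⟨
  # u (copies (2 + n) (treesOfSize (suc n)))   ∎
  where
  open ≡-Reasoning
  Sₙ = treesOfSize n
  pruned : ∀ u → sum (map (λ y → # y Sₙ) (prune u)) ≡ (2 + n) * # u (treesOfSize (suc n))
  pruned u with size u ≟ suc n
  pruned (fork l r) | yes su≡1+n = begin
    sum (map (λ y → # y Sₙ) (prune (fork l r)))   ≡⟨ sum-map-const (All.map (#-treesOfSize-≡ ∘ sizes) (size-prune (fork l r))) ⟩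
    length (prune (fork l r)) * 1                ≡⟨ cong₂ _*_ (trans (length-prune l r) (cong suc su≡1+n)) (sym (#-treesOfSize-≡ su≡1+n)) ⟩
    (2 + n) * # (fork l r) (treesOfSize (suc n)) ∎
    where
    sizes : ∀ {y} → suc (size y) ≡ size (fork l r) → size y ≡ n
    sizes eq = ℕ.suc-injective (trans eq su≡1+n)
  ... | no su≢1+n = begin
    sum (map (λ y → # y Sₙ) (prune u))   ≡⟨ sum-map-const (All.map (#-treesOfSize-≢ ∘ sizes) (size-prune u)) ⟩
    length (prune u) * 0                ≡⟨ ℕ.*-zeroʳ (length (prune u)) ⟩
    0                                   ≡⟨ ℕ.*-zeroʳ (2 + n) ⟨
    (2 + n) * 0                         ≡⟨ cong ((2 + n) *_) (#-treesOfSize-≢ su≢1+n) ⟨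
    (2 + n) * # u (treesOfSize (suc n)) ∎
    where
    sizes : ∀ {y} → suc (size y) ≡ size u → size y ≢ n
    sizes eq sy≡n = su≢1+n (trans (sym eq) (cong suc sy≡n))

-- Iterating the derivative

varDℕ : ℕPoly
varDℕ = (1 , mono 0 0 0 1 0) ∷ []

weightsOfSize : ℕ → List Mono
weightsOfSize n = map (weightB last) (treesOfSize n)

∂-weightsOfSize : ∀ n → concatMap ∂ (weightsOfSize (suc n)) ↭ copies (3 + n) (weightsOfSize (2 + n))
∂-weightsOfSize n = begin
  concatMap ∂ (map (weightB last) S₁)         ≡⟨ List.concatMap-map ∂ (weightB last) S₁ ⟩
  concatMap (∂ ∘ weightB last) S₁             ↭⟨ concatMap-cong-local-↭ S₁ (↭-sym ∘ grown) ⟩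
  concatMap (map (weightB last) ∘ grow) S₁    ≡⟨ List.map-concatMap (weightB last) grow S₁ ⟨
  map (weightB last) (concatMap grow S₁)      ↭⟨ ↭.map⁺ (weightB last) (grow-treesOfSize (suc n)) ⟩
  map (weightB last) (copies (3 + n) S₂)      ≡⟨ map-copies (weightB last) (3 + n) S₂ ⟩
  copies (3 + n) (weightsOfSize (2 + n))     ∎
  where
  open PermutationReasoning
  S₁  = treesOfSize (suc n)
  S₂ = treesOfSize (2 + n)
  grown : ∀ {t} → t ∈ S₁ → map (weightB last) (grow t) ↭ ∂ (weightB last t)
  grown {fork l r} _ = weights-grow last l r
  grown {leaf}   t∈S₁ with () ← Equivalence.to (∈-treesOfSize (suc n) leaf) t∈S₁

monomials-iterateDer : ∀ k → monomials (iterateDerℕ (2 + k) varDℕ) ↭ copies ((3 + k) !) (weightsOfSize (2 + k))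
-- The induction cannot start at n = 1: D(d) = 2b, whereas the one-edge tree has weight a.
monomials-iterateDer zero    = isPermutation-sound _ _ _
monomials-iterateDer (suc k) = begin
  monomials (Derℕ (iterateDerℕ (2 + k) varDℕ))          ↭⟨ monomials-Derℕ (iterateDerℕ (2 + k) varDℕ) ⟩
  concatMap ∂ (monomials (iterateDerℕ (2 + k) varDℕ))    ↭⟨ concatMap⁺ ∂ (monomials-iterateDer k) ⟩
  concatMap ∂ (copies K (weightsOfSize (2 + k)))         ≡⟨ concatMap-copies ∂ K (weightsOfSize (2 + k)) ⟩
  copies K (concatMap ∂ (weightsOfSize (2 + k)))         ↭⟨ copies⁺ K (∂-weightsOfSize (suc k)) ⟩
  copies K (copies (4 + k) (weightsOfSize (3 + k)))      ≡⟨ copies-* K (4 + k) (weightsOfSize (3 + k)) ⟩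
  copies (K * (4 + k)) (weightsOfSize (3 + k))           ≡⟨ cong (λ m → copies m (weightsOfSize (3 + k))) (ℕ.*-comm K (4 + k)) ⟩
  copies ((4 + k) !) (weightsOfSize (3 + k))             ∎
  where
  open PermutationReasoning
  K = (3 + k) !

-- The rotation correspondence

forest : Bin → List PTree
forest leaf       = []
forest (fork l r) = forest r ++ [ node (forest l) ]

plane : Bin → PTree
plane t = node (forest t)

extend : Bin → List PTree → Bin
extend acc []             = acc
extend acc (node cs ∷ ts) = extend (fork (extend leaf cs) acc) ts

binary : PTree → Bin
binary (node ts) = extend leaf ts

forest-extend : ∀ acc ts → forest (extend acc ts) ≡ forest acc ++ ts
forest-extend acc []             = sym (List.++-identityʳ (forest acc))
forest-extend acc (node cs ∷ ts) = begin
  forest (extend (fork (extend leaf cs) acc) ts)     ≡⟨ forest-extend (fork (extend leaf cs) acc) ts ⟩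
  (forest acc ++ [ node (forest (extend leaf cs)) ]) ++ ts ≡⟨ cong (λ cs′ → (forest acc ++ [ node cs′ ]) ++ ts) (forest-extend leaf cs) ⟩
  (forest acc ++ [ node cs ]) ++ ts                  ≡⟨ List.++-assoc (forest acc) [ node cs ] ts ⟩
  forest acc ++ node cs ∷ ts                         ∎
  where open ≡-Reasoning

plane-binary : ∀ T → plane (binary T) ≡ T
plane-binary (node ts) = cong node (forest-extend leaf ts)

extend-++ : ∀ acc xs ys → extend acc (xs ++ ys) ≡ extend (extend acc xs) ys
extend-++ acc []             ys = refl
extend-++ acc (node cs ∷ xs) ys = extend-++ (fork (extend leaf cs) acc) xs ys

binary-plane : ∀ t → binary (plane t) ≡ t
binary-plane leaf       = refl
binary-plane (fork l r) = trans (extend-++ leaf (forest r) [ node (forest l) ]) (cong₂ fork (binary-plane l) (binary-plane r))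

edgesList-++ : ∀ xs ys → edgesList (xs ++ ys) ≡ edgesList xs + edgesList ys
edgesList-++ []       ys = refl
edgesList-++ (x ∷ xs) ys = trans (cong (edges x +_) (edgesList-++ xs ys)) (sym (ℕ.+-assoc (edges x) _ _))

edges-plane : ∀ t → edges (plane t) ≡ size t
edges-plane leaf       = refl
edges-plane (fork l r) = begin
  length (forest r ++ [ node (forest l) ]) + edgesList (forest r ++ [ node (forest l) ])
    ≡⟨ cong₂ _+_ (List.length-++ (forest r)) (edgesList-++ (forest r) [ node (forest l) ]) ⟩
  (length (forest r) + 1) + (edgesList (forest r) + (edges (plane l) + 0))
    ≡⟨ rearrange (length (forest r)) (edgesList (forest r)) (edges (plane l)) ⟩
  suc (edges (plane l) + edges (plane r))
    ≡⟨ cong suc (cong₂ _+_ (edges-plane l) (edges-plane r)) ⟩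
  suc (size l + size r) ∎
  where
  open ≡-Reasoning
  rearrange : ∀ a b c → (a + 1) + (b + (c + 0)) ≡ suc (c + (a + b))
  rearrange = solve-∀

-- `yint` charges a vertex whose eldest child is interior; charging that child instead turns all
-- five statistics into sums over children.
isFirstInterior : ℕ → ℕ → PTree → Bool
isFirstInterior total pos c = (pos ≡ᵇ 0) ∧ not (isLeaf c)

hasSEChild-afterFirst : ∀ m p cs → hasSEChild (suc (suc m)) (suc p) cs ≡ false
hasSEChild-afterFirst m p []       = refl
hasSEChild-afterFirst m p (c ∷ cs) with isLeaf c
... | true  = hasSEChild-afterFirst m (suc p) cs
... | false = hasSEChild-afterFirst m (suc p) cs

isYoungInterior-∷ : ∀ c cs → isYoungInterior (c ∷ cs) ≡ not (isLeaf c)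
isYoungInterior-∷ c []        with isLeaf c
... | true  = refl
... | false = refl
isYoungInterior-∷ c (c′ ∷ cs) rewrite hasSEChild-afterFirst (length cs) 0 (c′ ∷ cs) with isLeaf c
... | true  = refl
... | false = refl

mutual
  yint-byFirstChild : ∀ T → yint T ≡ count noOwn isFirstInterior T
  yint-byFirstChild (node [])       = refl
  yint-byFirstChild (node (c ∷ cs)) = begin
    b2n (isYoungInterior (c ∷ cs)) + (yint c + countCh isYoungInterior noCh k 1 cs)
      ≡⟨ cong₂ _+_ (cong b2n (isYoungInterior-∷ c cs)) (cong₂ _+_ (yint-byFirstChild c) (yint-laterChildren k 0 cs)) ⟩
    b2n (not (isLeaf c)) + (count noOwn isFirstInterior c + countCh noOwn isFirstInterior k 1 cs)
      ≡⟨ ℕ.+-assoc (b2n (not (isLeaf c))) _ _ ⟨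
    b2n (not (isLeaf c)) + count noOwn isFirstInterior c + countCh noOwn isFirstInterior k 1 cs ∎
    where
    open ≡-Reasoning
    k = length (c ∷ cs)

  yint-laterChildren : ∀ k p cs → countCh isYoungInterior noCh k (suc p) cs ≡ countCh noOwn isFirstInterior k (suc p) cs
  yint-laterChildren k p []       = refl
  yint-laterChildren k p (c ∷ cs) = cong₂ _+_ (yint-byFirstChild c) (yint-laterChildren k (suc p) cs)

childWeight : ℕ → ℕ → PTree → Mono
childWeight total pos c = mono (b2n (isSingletonLeaf total pos c)) (b2n (isElderLeaf total pos c)) (b2n (isYoungLeaf total pos c))
                               (b2n (isFirstInterior total pos c)) (b2n (isYoungEdge total pos c))

degree : Bin → ℕ
degree leaf       = 0
degree (fork _ r) = suc (degree r)

length-forest : ∀ t → length (forest t) ≡ degree t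
length-forest leaf       = refl
length-forest (fork l r) = trans (List.length-++ (forest r)) (trans (ℕ.+-comm (length (forest r)) 1) (cong suc (length-forest r)))

-- The slot of a child followed by j younger siblings.
slotAfter : ℕ → Slot
slotAfter zero    = last
slotAfter (suc _) = earlier

isLeaf-plane-fork : ∀ l r → isLeaf (plane (fork l r)) ≡ false
isLeaf-plane-fork l r with forest r
... | []    = refl
... | _ ∷ _ = refl

childWeight-forest : ∀ l r j → childWeight (suc (degree r + j)) (degree r) (plane l) ≡ localWeight (slotAfter j) l r
childWeight-forest leaf         leaf       zero    = refl
childWeight-forest leaf         leaf       (suc j) = refl
childWeight-forest leaf         (fork _ _) j       = refl
childWeight-forest (fork l₁ l₂) leaf       j rewrite isLeaf-plane-fork l₁ l₂ = refl
childWeight-forest (fork l₁ l₂) (fork _ _) j rewrite isLeaf-plane-fork l₁ l₂ = refl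

countCh-++ : ∀ own ch total pos xs ys →
             countCh own ch total pos (xs ++ ys) ≡ countCh own ch total pos xs + countCh own ch total (pos + length xs) ys
countCh-++ own ch total pos []       ys = cong (λ p → countCh own ch total p ys) (sym (ℕ.+-identityʳ pos))
countCh-++ own ch total pos (c ∷ cs) ys =
  trans (cong (head +_) (countCh-++ own ch total (suc pos) cs ys))
        (trans (cong (λ p → head + (countCh own ch total (suc pos) cs + countCh own ch total p ys)) (sym (ℕ.+-suc pos (length cs))))
               (sym (ℕ.+-assoc head _ _)))
  where head = b2n (ch total pos c) + count own ch c

module ChildStatistic (ch : ℕ → ℕ → PTree → Bool) (i : Fin 5)
                      (ch-is-coordinate : ∀ total pos c → b2n (ch total pos c) ≡ lookup (childWeight total pos c) i) where

  countCh-forest : ∀ t j → countCh noOwn ch (degree t + j) 0 (forest t) ≡ lookup (weightB (slotAfter j) t) i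
  count-plane : ∀ t → count noOwn ch (plane t) ≡ lookup (weightB last t) i

  countCh-forest leaf       j = sym (Vec.lookup-replicate i 0)
  countCh-forest (fork l r) j = begin
    countCh noOwn ch total 0 (forest r ++ [ plane l ])
      ≡⟨ countCh-++ noOwn ch total 0 (forest r) [ plane l ] ⟩
    countCh noOwn ch total 0 (forest r) + (b2n (ch total (length (forest r)) (plane l)) + count noOwn ch (plane l) + 0)
      ≡⟨ cong₂ _+_ elder-siblings (cong (_+ 0) (cong₂ _+_ child (count-plane l))) ⟩
    lookup (weightB earlier r) i + (lookup (localWeight (slotAfter j) l r) i + lookup (weightB last l) i + 0)
      ≡⟨ rearrange (lookup (weightB earlier r) i) (lookup (localWeight (slotAfter j) l r) i) (lookup (weightB last l) i) ⟩
    lookup (localWeight (slotAfter j) l r) i + (lookup (weightB last l) i + lookup (weightB earlier r) i)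
      ≡⟨ lookup-⊕₃ (localWeight (slotAfter j) l r) (weightB last l) (weightB earlier r) ⟨
    lookup (weightB (slotAfter j) (fork l r)) i ∎
    where
    open ≡-Reasoning
    total = suc (degree r + j)
    elder-siblings : countCh noOwn ch total 0 (forest r) ≡ lookup (weightB earlier r) i
    elder-siblings = trans (cong (λ k → countCh noOwn ch k 0 (forest r)) (sym (ℕ.+-suc (degree r) j))) (countCh-forest r (suc j))
    child : b2n (ch total (length (forest r)) (plane l)) ≡ lookup (localWeight (slotAfter j) l r) i
    child = begin
      b2n (ch total (length (forest r)) (plane l))    ≡⟨ cong (λ p → b2n (ch total p (plane l))) (length-forest r) ⟩
      b2n (ch total (degree r) (plane l))             ≡⟨ ch-is-coordinate total (degree r) (plane l) ⟩
      lookup (childWeight total (degree r) (plane l)) i ≡⟨ cong (λ v → lookup v i) (childWeight-forest l r j) ⟩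
      lookup (localWeight (slotAfter j) l r) i        ∎
    rearrange : ∀ a b c → a + (b + c + 0) ≡ b + (c + a)
    rearrange = solve-∀
    lookup-⊕₃ : ∀ x y z → lookup (x ⊕ y ⊕ z) i ≡ lookup x i + (lookup y i + lookup z i)
    lookup-⊕₃ x y z = trans (Vec.lookup-zipWith _+_ i x (y ⊕ z)) (cong (lookup x i +_) (Vec.lookup-zipWith _+_ i y z))

  count-plane t =
    trans (cong (λ k → countCh noOwn ch k 0 (forest t)) (trans (length-forest t) (sym (ℕ.+-identityʳ (degree t)))))
          (countCh-forest t 0)

lookup-weight-plane : ∀ i t → lookup (weight (plane t)) i ≡ lookup (weightB last t) i
lookup-weight-plane zero                         = ChildStatistic.count-plane isSingletonLeaf zero (λ _ _ _ → refl)
lookup-weight-plane (suc zero)                   = ChildStatistic.count-plane isElderLeaf (suc zero) (λ _ _ _ → refl)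
lookup-weight-plane (suc (suc zero))             = ChildStatistic.count-plane isYoungLeaf (suc (suc zero)) (λ _ _ _ → refl)
lookup-weight-plane (suc (suc (suc zero))) t     =
  trans (yint-byFirstChild (plane t)) (ChildStatistic.count-plane isFirstInterior (suc (suc (suc zero))) (λ _ _ _ → refl) t)
lookup-weight-plane (suc (suc (suc (suc zero)))) = ChildStatistic.count-plane isYoungEdge (suc (suc (suc (suc zero)))) (λ _ _ _ → refl)

weight-plane : ∀ t → weight (plane t) ≡ weightB last t
weight-plane t = begin
  weight (plane t)                     ≡⟨ Vec.tabulate∘lookup (weight (plane t)) ⟨
  tabulate (lookup (weight (plane t))) ≡⟨ Vec.tabulate-cong (λ i → lookup-weight-plane i t) ⟩
  tabulate (lookup (weightB last t))   ≡⟨ Vec.tabulate∘lookup (weightB last t) ⟩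
  weightB last t                       ∎
  where open ≡-Reasoning

scaleP-GenPoly : ∀ K L → scaleP (ℕ→ℚ K) (GenPoly L) ≡ embed (map (K ,_) (map weight L))
scaleP-GenPoly K []      = refl
scaleP-GenPoly K (T ∷ L) = cong₂ _∷_ (cong (_, weight T) (ℚ.*-identityʳ (ℕ→ℚ K))) (scaleP-GenPoly K L)

monomials-map-const : ∀ K es → monomials (map (K ,_) es) ↭ copies K es
monomials-map-const K es = ↭-fromMultiplicities _ _ λ m → trans (multiplicities m es) (sym (multiplicity-copies m K es))
  where
  multiplicities : ∀ m es → multiplicity m (monomials (map (K ,_) es)) ≡ K * multiplicity m es
  multiplicities m []       = sym (ℕ.*-zeroʳ K)
  multiplicities m (e ∷ es) = begin
    multiplicity m (monomials (map (K ,_) (e ∷ es)))   ≡⟨ multiplicity-monomials-∷ K e (map (K ,_) es) m ⟩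
    K * δ e m + multiplicity m (monomials (map (K ,_) es)) ≡⟨ cong (K * δ e m +_) (multiplicities m es) ⟩
    K * δ e m + K * multiplicity m es                  ≡⟨ ℕ.*-distribˡ-+ K _ _ ⟨
    K * multiplicity m (e ∷ es)                        ∎
    where open ≡-Reasoning

weight-binary : ∀ T → weight T ≡ weightB last (binary T)
weight-binary T = trans (cong weight (sym (plane-binary T))) (weight-plane (binary T))

size-binary : ∀ T → size (binary T) ≡ edges T
size-binary T = trans (sym (edges-plane (binary T))) (cong edges (plane-binary T))

binary-injective : ∀ {T U} → binary T ≡ binary U → T ≡ U
binary-injective {T} {U} eq = trans (sym (plane-binary T)) (trans (cong plane eq) (plane-binary U))

binary-enumerates : ∀ n L → Unique L → (∀ T → T ∈ L ⇔ edges T ≡ n) → map binary L ↭ treesOfSize n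
binary-enumerates n L L! L-members = Trees.↭-fromSameMembers (Unique.map⁺ binary-injective L!) (treesOfSize-unique n) λ t → mk⇔ (to t) (from t)
  where
  to : ∀ t → t ∈ map binary L → t ∈ treesOfSize n
  to t t∈ with T , T∈L , refl ← ∈-map⁻ binary t∈ =
    Equivalence.from (∈-treesOfSize n (binary T)) (trans (size-binary T) (Equivalence.to (L-members T) T∈L))
  from : ∀ t → t ∈ treesOfSize n → t ∈ map binary L
  from t t∈ = subst (_∈ map binary L) (binary-plane t)
    (∈-map⁺ binary (Equivalence.from (L-members (plane t)) (trans (edges-plane t) (Equivalence.to (∈-treesOfSize n t) t∈))))

weights-enumeration : ∀ n L → Unique L → (∀ T → T ∈ L ⇔ edges T ≡ n) → map weight L ↭ weightsOfSize n
weights-enumeration n L L! L-members = begin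
  map weight L                       ≡⟨ trans (List.map-cong weight-binary L) (List.map-∘ L) ⟩
  map (weightB last) (map binary L)  ↭⟨ ↭.map⁺ (weightB last) (binary-enumerates n L L! L-members) ⟩
  weightsOfSize n                    ∎
  where open PermutationReasoning

theorem3p1 : (n : ℕ) → 2 ≤ n →
    (L : List PTree) → Unique L → (∀ (T : PTree) → (T ∈ L ⇔ edges T ≡ n)) →
    iterate n (Der grammar) varD ≈P scaleP (ℕ→ℚ (suc n !)) (GenPoly L)
theorem3p1 n@(suc (suc k)) (s≤s (s≤s z≤n)) L L! L-members m = begin
  coeff (iterate n (Der grammar) varD) m           ≡⟨ cong (λ p → coeff p m) (iterate-embed grammar grammar-embed n varDℕ) ⟩
  coeff (embed (iterateDerℕ n varDℕ)) m            ≡⟨ coeff-embed-↭ (iterateDerℕ n varDℕ) (map (K ,_) (map weight L)) D^n↭ m ⟩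
  coeff (embed (map (K ,_) (map weight L))) m      ≡⟨ cong (λ p → coeff p m) (scaleP-GenPoly K L) ⟨
  coeff (scaleP (ℕ→ℚ K) (GenPoly L)) m             ∎
  where
  open ≡-Reasoning
  K = suc n !
  D^n↭ : monomials (iterateDerℕ n varDℕ) ↭ monomials (map (K ,_) (map weight L))
  D^n↭ = ↭-trans (monomials-iterateDer k)
                 (↭-trans (copies⁺ K (↭-sym (weights-enumeration n L L! L-members))) (↭-sym (monomials-map-const K (map weight L))))
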